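{- Every infinite recursively enumerable set $A \subseteq \Sigma^\ast$ is $\mathrm{F_{PR}}$-compressible.
   Context: $\Sigma=\{0,1\}$. $\mathrm{F_{PR}}$ is the class of all partial recursive functions from $\Sigma^\ast$ to $\Sigma^\ast$. A (possibly partial) function $f$ is a compression function for $A \subseteq \Sigma^\ast$ if (a) $f$ is defined on every element of $A$, (b) $f(A) = \Sigma^\ast$, and (c) for all distinct $a,b\in A$, $f(a)\neq f(b)$ (no condition is placed on the behavior of $f$ outside $A$). A set $A$ is $\mathrm{F_{PR}}$-compressible if some $f\in \mathrm{F_{PR}}$ is a compression function for $A$. -}

module Defs where

open import Data.Nat using (ℕ; zero; suc; _+_; _*_; _<_)
open import Data.Bool using (Bool; true; false)
open import Data.Fin using (Fin)
open import Data.Vec using (Vec; []; _∷_; lookup)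
open import Data.List using (List; []; _∷_)
open import Data.List.Membership.Propositional using (_∉_)
open import Data.Product using (Σ; _×_)
open import Relation.Binary.PropositionalEquality using (_≡_; _≢_)

-- Σ* = List Bool (0 = false, 1 = true).

-- Standard computable bijection Σ* → ℕ (bijective base-2 numeration,
-- least significant symbol first): ε ↦ 0, b·w ↦ 1 + b + 2·enc w.
bit : Bool → ℕ
bit false = 0
bit true  = 1

enc : List Bool → ℕ
enc []       = 0
enc (b ∷ xs) = suc (bit b + 2 * enc xs)

-- Codes of μ-recursive (partial recursive) functions ℕⁿ ⇀ ℕ.
data Code : ℕ → Set where
  zeroC : ∀ {n} → Code n
  succC : Code 1
  projC : ∀ {n} → Fin n → Code n
  compC : ∀ {n m} → Code m → Vec (Code n) m → Code n
  precC : ∀ {n} → Code n → Code (suc (suc n)) → Code (suc n)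
  muC   : ∀ {n} → Code (suc n) → Code n

-- Big-step semantics: Eval c xs y  means  ⟦c⟧(xs) is defined and equals y.
mutual
  data Eval : ∀ {n} → Code n → Vec ℕ n → ℕ → Set where
    zeroE : ∀ {n} {xs : Vec ℕ n} → Eval zeroC xs 0
    succE : ∀ {x} → Eval succC (x ∷ []) (suc x)
    projE : ∀ {n} {i : Fin n} {xs} → Eval (projC i) xs (lookup xs i)
    compE : ∀ {n m} {f : Code m} {gs : Vec (Code n) m} {xs ys y} →
            EvalAll gs xs ys → Eval f ys y → Eval (compC f gs) xs y
    precZ : ∀ {n} {f : Code n} {g} {xs y} →
            Eval f xs y → Eval (precC f g) (0 ∷ xs) y
    precS : ∀ {n} {f : Code n} {g} {k xs r y} →
            Eval (precC f g) (k ∷ xs) r → Eval g (k ∷ r ∷ xs) y →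
            Eval (precC f g) (suc k ∷ xs) y
    muE   : ∀ {n} {f : Code (suc n)} {xs k} →
            Eval f (k ∷ xs) 0 →
            (∀ j → j < k → Σ ℕ λ r → Eval f (j ∷ xs) (suc r)) →
            Eval (muC f) xs k

  data EvalAll {n} : ∀ {m} → Vec (Code n) m → Vec ℕ n → Vec ℕ m → Set where
    []  : ∀ {xs} → EvalAll [] xs []
    _∷_ : ∀ {m g} {gs : Vec (Code n) m} {xs y ys} →
          Eval g xs y → EvalAll gs xs ys → EvalAll (g ∷ gs) xs (y ∷ ys)

-- The partial function Σ* ⇀ Σ* computed by a unary code (via enc on
-- input and output): PR c x y  means  f_c(x) is defined and equals y.
-- F_PR = { f_c | c : Code 1 }.
PR : Code 1 → List Bool → List Bool → Set
PR c x y = Eval c (enc x ∷ []) (enc y)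

DefinedAt : Code 1 → List Bool → Set
DefinedAt c x = Σ (List Bool) λ y → PR c x y

RE : (List Bool → Set) → Set
RE A = Σ (Code 1) λ c → ∀ x → (A x → DefinedAt c x) × (DefinedAt c x → A x)

Infinite : (List Bool → Set) → Set
Infinite A = (xs : List (List Bool)) → Σ (List Bool) λ a → A a × a ∉ xs

IsCompressionFunction : Code 1 → (List Bool → Set) → Set
IsCompressionFunction c A =
  ((a : List Bool) → A a → DefinedAt c a) ×
  ((w : List Bool) → Σ (List Bool) λ a → A a × PR c a w) ×
  ((a b : List Bool) → A a → A b → a ≢ b →
     (u v : List Bool) → PR c a u → PR c b v → u ≢ v)

FPR-Compressible : (List Bool → Set) → Set
FPR-Compressible A = Σ (Code 1) λ c → IsCompressionFunction c A

-- Let c be a code whose domain is A, and say that y is enumerated by time t when y < t and c halts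
-- on y within budget t of a clocked evaluation; clocked evaluation is primitive recursive. Order A
-- by the stage at which an element is first enumerated, then by value. Each stage enumerates only
-- finitely many elements, so when A is infinite this order has type ω, and the map sending x to the
-- number of elements preceding it is a bijection from A onto ℕ. It is partial recursive: the stage of
-- x is found by unbounded search, and the predecessors of x all lie below its stage.

module Submission where

open import Defs
open import Data.Bool using (Bool; true; false; T; not; _∧_; _∨_; if_then_else_)
open import Data.Bool.Properties using (T-∧; T-∨)
open import Data.Empty using (⊥-elim)
open import Data.List as List using (List; []; _∷_; upTo)
open import Data.List.Membership.Propositional using (_∈_)
open import Data.List.Membership.Propositional.Properties using (∈-map⁺; ∈-upTo⁺)
open import Data.Fin using (Fin; zero; suc)
open import Data.Nat using (ℕ; zero; suc; _+_; _*_; _∸_; _<_; _≤_; _<ᵇ_; _<?_; pred; _⊔_; z≤n; s≤s; s≤s⁻¹)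
open import Data.Nat.Properties
open import Data.Product using (∃; ∃-syntax; _×_; _,_; proj₁; proj₂)
open import Data.Sum using (_⊎_; inj₁; inj₂)
open import Data.Vec using (Vec; []; _∷_; lookup; map; tabulate)
open import Data.Vec.Properties using (∷-injectiveˡ; ∷-injectiveʳ)
open import Function.Bundles using (Equivalence)
open import Level using (0ℓ)
open import Relation.Binary.Definitions using (tri<; tri≈; tri>)
open import Relation.Binary.PropositionalEquality
open import Relation.Nullary using (yes; no; ¬_; does; contradiction)
open import Relation.Nullary.Decidable using (T?)
open import Relation.Unary using (Pred; Decidable; _⊆_)

mutual
  Eval-functional : ∀ {n} (c : Code n) {xs y y′} → Eval c xs y → Eval c xs y′ → y ≡ y′
  Eval-functional zeroC     zeroE zeroE = refl
  Eval-functional succC     succE succE = refl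
  Eval-functional (projC i) projE projE = refl
  Eval-functional (compC f gs) (compE es e) (compE es′ e′) with EvalAll-functional gs es es′
  ... | refl = Eval-functional f e e′
  Eval-functional (precC f g) (precZ e) (precZ e′) = Eval-functional f e e′
  Eval-functional (precC f g) (precS d e) (precS d′ e′) with Eval-functional (precC f g) d d′
  ... | refl = Eval-functional g e e′
  Eval-functional (muC f) (muE {k = k} e below) (muE {k = k′} e′ below′) with <-cmp k k′
  ... | tri≈ _ k≡k′ _ = k≡k′
  ... | tri< k<k′ _ _ = ⊥-elim (0≢1+n (Eval-functional f e (proj₂ (below′ k k<k′))))
  ... | tri> _ _ k>k′ = ⊥-elim (0≢1+n (Eval-functional f e′ (proj₂ (below k′ k>k′))))

  EvalAll-functional : ∀ {n m} (gs : Vec (Code n) m) {xs ys ys′} →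
                       EvalAll gs xs ys → EvalAll gs xs ys′ → ys ≡ ys′
  EvalAll-functional []       []       []         = refl
  EvalAll-functional (g ∷ gs) (e ∷ es) (e′ ∷ es′) =
    cong₂ _∷_ (Eval-functional g e e′) (EvalAll-functional gs es es′)

π₀ : ∀ {n} → Code (suc n)
π₀ = projC zero

π₁ : ∀ {n} → Code (suc (suc n))
π₁ = projC (suc zero)

π₂ : ∀ {n} → Code (suc (suc (suc n)))
π₂ = projC (suc (suc zero))

π₃ : ∀ {n} → Code (suc (suc (suc (suc n))))
π₃ = projC (suc (suc (suc zero)))

projsᶜ : ∀ {m n} → (Fin n → Fin m) → Vec (Code m) n
projsᶜ ρ = tabulate (λ i → projC (ρ i))

projsᶜ-eval : ∀ {m n} (ρ : Fin n → Fin m) {zs : Vec ℕ m} (xs : Vec ℕ n) →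
              (∀ i → lookup zs (ρ i) ≡ lookup xs i) → EvalAll (projsᶜ ρ) zs xs
projsᶜ-eval ρ {zs} []       ρ-ok = []
projsᶜ-eval ρ {zs} (x ∷ xs) ρ-ok =
  subst (Eval (projC (ρ zero)) zs) (ρ-ok zero) projE ∷ projsᶜ-eval (λ i → ρ (suc i)) xs (λ i → ρ-ok (suc i))

ifz : ℕ → ℕ → ℕ → ℕ
ifz zero    b c = b
ifz (suc _) b c = c

ifzCode-eval : ∀ a b c → Eval (precC π₀ π₃) (a ∷ b ∷ c ∷ []) (ifz a b c)
ifzCode-eval zero    b c = precZ projE
ifzCode-eval (suc a) b c = precS (ifzCode-eval a b c) projE

ifzᶜ : ∀ {n} → Code n → Code n → Code n → Code n
ifzᶜ a b c = compC (precC π₀ π₃) (a ∷ b ∷ c ∷ [])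

ifzᶜ-eval : ∀ {n} {a b c : Code n} {xs u v w} →
            Eval a xs u → Eval b xs v → Eval c xs w → Eval (ifzᶜ a b c) xs (ifz u v w)
ifzᶜ-eval ea eb ec = compE (ea ∷ eb ∷ ec ∷ []) (ifzCode-eval _ _ _)

predCode-eval : ∀ a → Eval (precC zeroC π₀) (a ∷ []) (pred a)
predCode-eval zero    = precZ zeroE
predCode-eval (suc a) = precS (predCode-eval a) projE

predᶜ : ∀ {n} → Code n → Code n
predᶜ a = compC (precC zeroC π₀) (a ∷ [])

predᶜ-eval : ∀ {n} {a : Code n} {xs v} → Eval a xs v → Eval (predᶜ a) xs (pred v)
predᶜ-eval e = compE (e ∷ []) (predCode-eval _)

sucᶜ : ∀ {n} → Code n → Code n
sucᶜ a = compC succC (a ∷ [])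

sucᶜ-eval : ∀ {n} {a : Code n} {xs v} → Eval a xs v → Eval (sucᶜ a) xs (suc v)
sucᶜ-eval e = compE (e ∷ []) succE

oneᶜ : ∀ {n} → Code n
oneᶜ = sucᶜ zeroC

oneᶜ-eval : ∀ {n} {xs : Vec ℕ n} → Eval oneᶜ xs 1
oneᶜ-eval = sucᶜ-eval zeroE

monusCode-eval : ∀ k m → Eval (precC π₀ (predᶜ π₁)) (k ∷ m ∷ []) (m ∸ k)
monusCode-eval zero    m = precZ projE
monusCode-eval (suc k) m =
  subst (Eval _ (suc k ∷ m ∷ [])) (pred[m∸n]≡m∸[1+n] m k)
        (precS (monusCode-eval k m) (predᶜ-eval projE))

monusᶜ : ∀ {n} → Code n → Code n → Code n
monusᶜ a b = compC (precC π₀ (predᶜ π₁)) (b ∷ a ∷ [])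

monusᶜ-eval : ∀ {n} {a b : Code n} {xs u v} → Eval a xs u → Eval b xs v → Eval (monusᶜ a b) xs (u ∸ v)
monusᶜ-eval ea eb = compE (eb ∷ ea ∷ []) (monusCode-eval _ _)

-- Boolean codes, with truth values represented by bit

ifᶜ_then_else_ : ∀ {n} → Code n → Code n → Code n → Code n
ifᶜ p then a else b = ifzᶜ p b a

ifᶜ-eval : ∀ {n} {p a b : Code n} {xs q u v} → Eval p xs (bit q) → Eval a xs u → Eval b xs v →
           Eval (ifᶜ p then a else b) xs (if q then u else v)
ifᶜ-eval {q = false} ep ea eb = ifzᶜ-eval ep eb ea
ifᶜ-eval {q = true}  ep ea eb = ifzᶜ-eval ep eb ea

notᶜ : ∀ {n} → Code n → Code n
notᶜ p = ifᶜ p then zeroC else oneᶜ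

notᶜ-eval : ∀ {n} {p : Code n} {xs q} → Eval p xs (bit q) → Eval (notᶜ p) xs (bit (not q))
notᶜ-eval {q = false} ep = ifᶜ-eval ep zeroE oneᶜ-eval
notᶜ-eval {q = true}  ep = ifᶜ-eval ep zeroE oneᶜ-eval

_∧ᶜ_ : ∀ {n} → Code n → Code n → Code n
p ∧ᶜ r = ifᶜ p then r else zeroC

∧ᶜ-eval : ∀ {n} {p r : Code n} {xs q s} → Eval p xs (bit q) → Eval r xs (bit s) →
          Eval (p ∧ᶜ r) xs (bit (q ∧ s))
∧ᶜ-eval {q = false} ep er = ifᶜ-eval ep er zeroE
∧ᶜ-eval {q = true}  ep er = ifᶜ-eval ep er zeroE

_∨ᶜ_ : ∀ {n} → Code n → Code n → Code n
p ∨ᶜ r = ifᶜ p then oneᶜ else r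

∨ᶜ-eval : ∀ {n} {p r : Code n} {xs q s} → Eval p xs (bit q) → Eval r xs (bit s) →
          Eval (p ∨ᶜ r) xs (bit (q ∨ s))
∨ᶜ-eval {q = false} ep er = ifᶜ-eval ep oneᶜ-eval er
∨ᶜ-eval {q = true}  ep er = ifᶜ-eval ep oneᶜ-eval er

positiveᶜ : ∀ {n} → Code n → Code n
positiveᶜ a = ifzᶜ a zeroC oneᶜ

positiveᶜ-eval : ∀ {n} {a : Code n} {xs v} → Eval a xs v → Eval (positiveᶜ a) xs (bit (0 <ᵇ v))
positiveᶜ-eval {v = zero}  e = ifzᶜ-eval e zeroE oneᶜ-eval
positiveᶜ-eval {v = suc _} e = ifzᶜ-eval e zeroE oneᶜ-eval

0<ᵇm∸n≡n<ᵇm : ∀ m n → (0 <ᵇ m ∸ n) ≡ (n <ᵇ m)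
0<ᵇm∸n≡n<ᵇm zero    zero    = refl
0<ᵇm∸n≡n<ᵇm zero    (suc n) = refl
0<ᵇm∸n≡n<ᵇm (suc m) zero    = refl
0<ᵇm∸n≡n<ᵇm (suc m) (suc n) = 0<ᵇm∸n≡n<ᵇm m n

_<ᶜ_ : ∀ {n} → Code n → Code n → Code n
a <ᶜ b = positiveᶜ (monusᶜ b a)

<ᶜ-eval : ∀ {n} {a b : Code n} {xs u v} → Eval a xs u → Eval b xs v → Eval (a <ᶜ b) xs (bit (u <ᵇ v))
<ᶜ-eval {a = a} {b} {xs} {u} {v} ea eb =
  subst (λ q → Eval (a <ᶜ b) xs (bit q)) (0<ᵇm∸n≡n<ᵇm v u) (positiveᶜ-eval (monusᶜ-eval eb ea))

-- Clocked evaluation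

allPositive : ∀ {m} → Vec ℕ m → ℕ
allPositive []       = 1
allPositive (r ∷ rs) = ifz r 0 (allPositive rs)

searchStep : ℕ → ℕ → ℕ
searchStep r b = ifz r 1 (ifz (pred r) (suc (suc b)) 0)

-- run c t xs is 0 if c has produced no value on xs within budget t, and suc y if it has produced y;
-- the budget only limits minimisation, which tries the arguments j < t.
mutual
  run : ∀ {n} → Code n → ℕ → Vec ℕ n → ℕ
  run zeroC        t xs       = 1
  run succC        t (x ∷ []) = suc (suc x)
  run (projC i)    t xs       = suc (lookup xs i)
  run (compC f gs) t xs       = ifz (allPositive (runAll gs t xs)) 0 (run f t (map pred (runAll gs t xs)))
  run (precC f g)  t (k ∷ xs) = runRec f g t k xs
  run (muC f)      t xs       = pred (search f t xs t)

  runAll : ∀ {n m} → Vec (Code n) m → ℕ → Vec ℕ n → Vec ℕ m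
  runAll []       t xs = []
  runAll (g ∷ gs) t xs = run g t xs ∷ runAll gs t xs

  runRec : ∀ {n} → Code n → Code (suc (suc n)) → ℕ → ℕ → Vec ℕ n → ℕ
  runRec f g t zero    xs = run f t xs
  runRec f g t (suc k) xs = ifz (runRec f g t k xs) 0 (run g t (k ∷ pred (runRec f g t k xs) ∷ xs))

  -- search f t xs b scans the arguments j < b: 0 while every f(j, xs) is positive,
  -- 1 once some f(j, xs) has no value within t, suc (suc k) once f(k, xs) = 0.
  search : ∀ {n} → Code (suc n) → ℕ → Vec ℕ n → ℕ → ℕ
  search f t xs zero    = 0
  search f t xs (suc b) = ifz (search f t xs b) (searchStep (run f t (b ∷ xs)) b) (search f t xs b)

mutual
  runᶜ : ∀ {n} → Code n → Code (suc n)
  runᶜ zeroC        = oneᶜ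
  runᶜ succC        = sucᶜ (sucᶜ π₁)
  runᶜ (projC i)    = sucᶜ (projC (suc i))
  runᶜ (compC f gs) = ifzᶜ (allPositiveᶜ gs) zeroC (compC (runᶜ f) (π₀ ∷ predRunAllᶜ gs))
  runᶜ (precC f g)  = compC (runRecᶜ f g) (π₁ ∷ π₀ ∷ projsᶜ (λ i → suc (suc i)))
  runᶜ (muC f)      = predᶜ (compC (searchᶜ f) (π₀ ∷ π₀ ∷ projsᶜ suc))

  allPositiveᶜ : ∀ {n m} → Vec (Code n) m → Code (suc n)
  allPositiveᶜ []       = oneᶜ
  allPositiveᶜ (g ∷ gs) = ifzᶜ (runᶜ g) zeroC (allPositiveᶜ gs)

  predRunAllᶜ : ∀ {n m} → Vec (Code n) m → Vec (Code (suc n)) m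
  predRunAllᶜ []       = []
  predRunAllᶜ (g ∷ gs) = predᶜ (runᶜ g) ∷ predRunAllᶜ gs

  -- arguments k ∷ t ∷ xs
  runRecᶜ : ∀ {n} → Code n → Code (suc (suc n)) → Code (suc (suc n))
  runRecᶜ f g =
    precC (runᶜ f) (ifzᶜ π₁ zeroC (compC (runᶜ g) (π₂ ∷ π₀ ∷ predᶜ π₁ ∷ projsᶜ (λ i → suc (suc (suc i))))))

  -- arguments b ∷ t ∷ xs
  searchᶜ : ∀ {n} → Code (suc n) → Code (suc (suc n))
  searchᶜ f =
    precC zeroC (ifzᶜ π₁ (ifzᶜ (runAtᶜ f) oneᶜ (ifzᶜ (predᶜ (runAtᶜ f)) (sucᶜ (sucᶜ π₀)) zeroC)) π₁)

  -- arguments b ∷ r ∷ t ∷ xs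
  runAtᶜ : ∀ {n} → Code (suc n) → Code (suc (suc (suc n)))
  runAtᶜ f = compC (runᶜ f) (π₂ ∷ π₀ ∷ projsᶜ (λ i → suc (suc (suc i))))

mutual
  runᶜ-eval : ∀ {n} (c : Code n) t xs → Eval (runᶜ c) (t ∷ xs) (run c t xs)
  runᶜ-eval zeroC        t xs       = oneᶜ-eval
  runᶜ-eval succC        t (x ∷ []) = sucᶜ-eval (sucᶜ-eval projE)
  runᶜ-eval (projC i)    t xs       = sucᶜ-eval projE
  runᶜ-eval (compC f gs) t xs       =
    ifzᶜ-eval (allPositiveᶜ-eval gs t xs) zeroE (compE (projE ∷ predRunAllᶜ-eval gs t xs) (runᶜ-eval f t _))
  runᶜ-eval (precC f g)  t (k ∷ xs) =
    compE (projE ∷ projE ∷ projsᶜ-eval _ xs (λ i → refl)) (runRecᶜ-eval f g k t xs)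
  runᶜ-eval (muC f)      t xs       =
    predᶜ-eval (compE (projE ∷ projE ∷ projsᶜ-eval _ xs (λ i → refl)) (searchᶜ-eval f t t xs))

  allPositiveᶜ-eval : ∀ {n m} (gs : Vec (Code n) m) t xs →
                      Eval (allPositiveᶜ gs) (t ∷ xs) (allPositive (runAll gs t xs))
  allPositiveᶜ-eval []       t xs = oneᶜ-eval
  allPositiveᶜ-eval (g ∷ gs) t xs = ifzᶜ-eval (runᶜ-eval g t xs) zeroE (allPositiveᶜ-eval gs t xs)

  predRunAllᶜ-eval : ∀ {n m} (gs : Vec (Code n) m) t xs → EvalAll (predRunAllᶜ gs) (t ∷ xs) (map pred (runAll gs t xs))
  predRunAllᶜ-eval []       t xs = []
  predRunAllᶜ-eval (g ∷ gs) t xs = predᶜ-eval (runᶜ-eval g t xs) ∷ predRunAllᶜ-eval gs t xs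

  runRecᶜ-eval : ∀ {n} (f : Code n) g k t xs → Eval (runRecᶜ f g) (k ∷ t ∷ xs) (runRec f g t k xs)
  runRecᶜ-eval f g zero    t xs = precZ (runᶜ-eval f t xs)
  runRecᶜ-eval f g (suc k) t xs = precS (runRecᶜ-eval f g k t xs)
    (ifzᶜ-eval projE zeroE
               (compE (projE ∷ projE ∷ predᶜ-eval projE ∷ projsᶜ-eval _ xs (λ i → refl)) (runᶜ-eval g t _)))

  searchᶜ-eval : ∀ {n} (f : Code (suc n)) b t xs → Eval (searchᶜ f) (b ∷ t ∷ xs) (search f t xs b)
  searchᶜ-eval f zero    t xs = precZ zeroE
  searchᶜ-eval f (suc b) t xs = precS (searchᶜ-eval f b t xs)
    (ifzᶜ-eval projE (ifzᶜ-eval (runAtᶜ-eval f b t xs) oneᶜ-eval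
                                (ifzᶜ-eval (predᶜ-eval (runAtᶜ-eval f b t xs)) (sucᶜ-eval (sucᶜ-eval projE)) zeroE))
               projE)

  runAtᶜ-eval : ∀ {n} (f : Code (suc n)) b t xs {r} → Eval (runAtᶜ f) (b ∷ r ∷ t ∷ xs) (run f t (b ∷ xs))
  runAtᶜ-eval f b t xs = compE (projE ∷ projE ∷ projsᶜ-eval _ xs (λ i → refl)) (runᶜ-eval f t (b ∷ xs))

allPositive-inv : ∀ {m} (rs : Vec ℕ m) {v y} → ifz (allPositive rs) 0 v ≡ suc y →
                  ∃[ ys ] rs ≡ map suc ys × v ≡ suc y
allPositive-inv []           eq = [] , refl , eq
allPositive-inv (zero  ∷ rs) eq = ⊥-elim (0≢1+n eq)
allPositive-inv (suc r ∷ rs) eq with allPositive-inv rs eq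
... | ys , rs≡ , v≡ = r ∷ ys , cong (suc r ∷_) rs≡ , v≡

allPositive-map-suc : ∀ {m} (ys : Vec ℕ m) → allPositive (map suc ys) ≡ 1
allPositive-map-suc []       = refl
allPositive-map-suc (y ∷ ys) = allPositive-map-suc ys

map-pred-map-suc : ∀ {m} (ys : Vec ℕ m) → map pred (map suc ys) ≡ ys
map-pred-map-suc []       = refl
map-pred-map-suc (y ∷ ys) = cong (y ∷_) (map-pred-map-suc ys)

module Search {n} (f : Code (suc n)) (t : ℕ) (xs : Vec ℕ n) where

  S : ℕ → ℕ
  S = search f t xs

  R : ℕ → ℕ
  R j = run f t (j ∷ xs)

  PositiveBelow : ℕ → Set
  PositiveBelow k = ∀ j → j < k → ∃[ r ] R j ≡ suc (suc r)

  searching⇒ : ∀ b → S b ≡ 0 → PositiveBelow b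
  searching⇒ (suc b) eq j j<1+b with S b in Sb≡ | R b in Rb≡
  ... | suc _ | _           = ⊥-elim (1+n≢0 eq)
  ... | zero  | zero        = ⊥-elim (1+n≢0 eq)
  ... | zero  | suc zero    = ⊥-elim (1+n≢0 eq)
  ... | zero  | suc (suc r) with m<1+n⇒m<n∨m≡n j<1+b
  ...   | inj₁ j<b  = searching⇒ b Sb≡ j j<b
  ...   | inj₂ refl = r , Rb≡

  searching⇐ : ∀ b → PositiveBelow b → S b ≡ 0
  searching⇐ zero    pos = refl
  searching⇐ (suc b) pos rewrite searching⇐ b (λ j j<b → pos j (m<n⇒m<1+n j<b))
    with pos b (n<1+n b)
  ... | r , Rb≡ rewrite Rb≡ = refl

  found⇒ : ∀ b {k} → S b ≡ suc (suc k) → k < b × R k ≡ 1 × PositiveBelow k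
  found⇒ (suc b) eq with S b in Sb≡
  ... | suc _ with found⇒ b (trans Sb≡ eq)
  ...   | k<b , Rk≡ , pos = m<n⇒m<1+n k<b , Rk≡ , pos
  found⇒ (suc b) eq | zero with R b in Rb≡
  ...   | zero        = ⊥-elim (0≢1+n (suc-injective eq))
  ...   | suc (suc r) = ⊥-elim (0≢1+n eq)
  ...   | suc zero with suc-injective (suc-injective eq)
  ...     | refl = n<1+n b , Rb≡ , searching⇒ b Sb≡

  search-stable : ∀ d b {s} → S b ≡ suc s → S (d + b) ≡ suc s
  search-stable zero    b eq = eq
  search-stable (suc d) b eq rewrite search-stable d b eq = refl

  found⇐ : ∀ b k → k < b → R k ≡ 1 → PositiveBelow k → S b ≡ suc (suc k)
  found⇐ b k k<b Rk≡ pos =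
    subst (λ c → S c ≡ suc (suc k)) (m∸n+n≡m k<b) (search-stable (b ∸ suc k) (suc k) found-at-k)
    where
    found-at-k : S (suc k) ≡ suc (suc k)
    found-at-k rewrite searching⇐ k pos | Rk≡ = refl

mutual
  run-sound : ∀ {n} (c : Code n) t xs {y} → run c t xs ≡ suc y → Eval c xs y
  run-sound zeroC     t xs       refl = zeroE
  run-sound succC     t (x ∷ []) refl = succE
  run-sound (projC i) t xs       refl = projE
  run-sound (compC f gs) t xs eq with allPositive-inv (runAll gs t xs) eq
  ... | ys , gs≡ , f≡ = compE (runAll-sound gs t xs ys gs≡) (run-sound f t ys f≡′)
    where
    f≡′ : run f t ys ≡ suc _
    f≡′ = subst (λ zs → run f t zs ≡ suc _)
                (trans (cong (map pred) gs≡) (map-pred-map-suc ys)) f≡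
  run-sound (precC f g) t (k ∷ xs) eq = runRec-sound f g t k xs eq
  run-sound (muC f) t xs eq with search f t xs t in S≡
  ... | zero        = ⊥-elim (0≢1+n eq)
  ... | suc zero    = ⊥-elim (0≢1+n eq)
  ... | suc (suc k) with Search.found⇒ f t xs t S≡ | suc-injective eq
  ...   | _ , Rk≡ , pos | refl =
    muE (run-sound f t (k ∷ xs) Rk≡) (λ j j<k → proj₁ (pos j j<k) , run-sound f t (j ∷ xs) (proj₂ (pos j j<k)))

  runAll-sound : ∀ {n m} (gs : Vec (Code n) m) t xs ys → runAll gs t xs ≡ map suc ys → EvalAll gs xs ys
  runAll-sound []       t xs []       eq = []
  runAll-sound (g ∷ gs) t xs (y ∷ ys) eq =
    run-sound g t xs (∷-injectiveˡ eq) ∷ runAll-sound gs t xs ys (∷-injectiveʳ eq)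

  runRec-sound : ∀ {n} (f : Code n) g t k xs {y} → runRec f g t k xs ≡ suc y → Eval (precC f g) (k ∷ xs) y
  runRec-sound f g t zero    xs eq = precZ (run-sound f t xs eq)
  runRec-sound f g t (suc k) xs eq with runRec f g t k xs in rec≡
  ... | zero  = ⊥-elim (0≢1+n eq)
  ... | suc r = precS (runRec-sound f g t k xs rec≡) (run-sound g t _ eq)

mutual
  run-mono : ∀ {n} (c : Code n) {t t′} xs {y} → t ≤ t′ → run c t xs ≡ suc y → run c t′ xs ≡ suc y
  run-mono zeroC     xs       t≤t′ eq = eq
  run-mono succC     (x ∷ []) t≤t′ eq = eq
  run-mono (projC i) xs       t≤t′ eq = eq
  run-mono (compC f gs) {t} xs t≤t′ eq with allPositive-inv (runAll gs t xs) eq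
  ... | ys , gs≡ , f≡
    rewrite runAll-mono gs xs ys t≤t′ gs≡ | allPositive-map-suc ys | map-pred-map-suc ys =
    run-mono f ys t≤t′ (subst (λ zs → run f t zs ≡ suc _) (trans (cong (map pred) gs≡) (map-pred-map-suc ys)) f≡)
  run-mono (precC f g) (k ∷ xs) t≤t′ eq = runRec-mono f g k xs t≤t′ eq
  run-mono (muC f) {t} {t′} xs t≤t′ eq with search f t xs t in S≡
  ... | zero        = ⊥-elim (0≢1+n eq)
  ... | suc zero    = ⊥-elim (0≢1+n eq)
  ... | suc (suc k) with Search.found⇒ f t xs t S≡
  ...   | k<t , Rk≡ , pos
    rewrite Search.found⇐ f t′ xs t′ k (<-≤-trans k<t t≤t′) (run-mono f (k ∷ xs) t≤t′ Rk≡)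
              (positiveBelow-mono f xs t≤t′ pos) = eq

  positiveBelow-mono : ∀ {n} (f : Code (suc n)) xs {t t′ k} → t ≤ t′ →
                       Search.PositiveBelow f t xs k → Search.PositiveBelow f t′ xs k
  positiveBelow-mono f xs t≤t′ pos j j<k with pos j j<k
  ... | r , Rj≡ = r , run-mono f (j ∷ xs) t≤t′ Rj≡

  runAll-mono : ∀ {n m} (gs : Vec (Code n) m) {t t′} xs ys → t ≤ t′ →
                runAll gs t xs ≡ map suc ys → runAll gs t′ xs ≡ map suc ys
  runAll-mono []       xs []       t≤t′ eq = refl
  runAll-mono (g ∷ gs) xs (y ∷ ys) t≤t′ eq =
    cong₂ _∷_ (run-mono g xs t≤t′ (∷-injectiveˡ eq)) (runAll-mono gs xs ys t≤t′ (∷-injectiveʳ eq))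

  runRec-mono : ∀ {n} (f : Code n) g {t t′} k xs {y} → t ≤ t′ →
                runRec f g t k xs ≡ suc y → runRec f g t′ k xs ≡ suc y
  runRec-mono f g zero    xs t≤t′ eq = run-mono f xs t≤t′ eq
  runRec-mono f g {t} (suc k) xs t≤t′ eq with runRec f g t k xs in rec≡
  ... | zero  = ⊥-elim (0≢1+n eq)
  ... | suc r rewrite runRec-mono f g k xs t≤t′ rec≡ = run-mono g _ t≤t′ eq

uniform-bound : (P : ℕ → ℕ → Set) → (∀ {j t t′} → t ≤ t′ → P j t → P j t′) →
                ∀ k → (∀ j → j < k → ∃ (P j)) → ∃[ T ] ∀ j → j < k → P j T
uniform-bound P mono zero    bounds = 0 , λ j ()
uniform-bound P mono (suc k) bounds
  with uniform-bound P mono k (λ j j<k → bounds j (m<n⇒m<1+n j<k)) | bounds k (n<1+n k)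
... | T , below-k | t , at-k = T ⊔ t , below-1+k
  where
  below-1+k : ∀ j → j < suc k → P j (T ⊔ t)
  below-1+k j j<1+k with m<1+n⇒m<n∨m≡n j<1+k
  ... | inj₁ j<k  = mono (m≤m⊔n T t) (below-k j j<k)
  ... | inj₂ refl = mono (m≤n⊔m T t) at-k

mutual
  run-complete : ∀ {n} (c : Code n) {xs y} → Eval c xs y → ∃[ t ] run c t xs ≡ suc y
  run-complete zeroC     zeroE = 0 , refl
  run-complete succC     succE = 0 , refl
  run-complete (projC i) projE = 0 , refl
  run-complete (compC f gs) {xs} (compE {ys = ys} es e) with runAll-complete gs es | run-complete f e
  ... | t₁ , gs≡ | t₂ , f≡ = t₁ ⊔ t₂ , f-at
    where
    f-at : run (compC f gs) (t₁ ⊔ t₂) xs ≡ suc _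
    f-at rewrite runAll-mono gs xs ys (m≤m⊔n t₁ t₂) gs≡ | allPositive-map-suc ys | map-pred-map-suc ys =
      run-mono f ys (m≤n⊔m t₁ t₂) f≡
  run-complete (precC f g) (precZ e) = run-complete f e
  run-complete (precC f g) {_ ∷ xs} (precS {k = k} d e) with run-complete (precC f g) d | run-complete g e
  ... | t₁ , rec≡ | t₂ , g≡ = t₁ ⊔ t₂ , rec-at
    where
    rec-at : runRec f g (t₁ ⊔ t₂) (suc k) xs ≡ suc _
    rec-at rewrite runRec-mono f g k xs (m≤m⊔n t₁ t₂) rec≡ = run-mono g _ (m≤n⊔m t₁ t₂) g≡
  run-complete (muC f) {xs} (muE {k = k} e below) with run-complete f e | run-complete-below f k below
  ... | t₀ , Rk≡ | T , pos = t , found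
    where
    t = (t₀ ⊔ T) ⊔ suc k
    t₀⊔T≤t : t₀ ⊔ T ≤ t
    t₀⊔T≤t = m≤m⊔n (t₀ ⊔ T) (suc k)
    found : pred (search f t xs t) ≡ suc k
    found rewrite Search.found⇐ f t xs t k (m≤n⊔m (t₀ ⊔ T) (suc k))
                    (run-mono f (k ∷ xs) (≤-trans (m≤m⊔n t₀ T) t₀⊔T≤t) Rk≡)
                    (positiveBelow-mono f xs (≤-trans (m≤n⊔m t₀ T) t₀⊔T≤t) pos) = refl

  run-complete-below : ∀ {n} (f : Code (suc n)) {xs} k → (∀ j → j < k → ∃[ r ] Eval f (j ∷ xs) (suc r)) →
                       ∃[ T ] Search.PositiveBelow f T xs k
  run-complete-below f {xs} k below =
    uniform-bound (λ j t → ∃[ r ] run f t (j ∷ xs) ≡ suc (suc r))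
                  (λ t≤t′ (r , Rj≡) → r , run-mono f _ t≤t′ Rj≡) k eventually-positive
    where
    eventually-positive : ∀ j → j < k → ∃[ t ] ∃[ r ] run f t (j ∷ xs) ≡ suc (suc r)
    eventually-positive j j<k with below j j<k
    ... | r , e with run-complete f e
    ...   | t , Rj≡ = t , r , Rj≡

  runAll-complete : ∀ {n m} (gs : Vec (Code n) m) {xs ys} → EvalAll gs xs ys → ∃[ t ] runAll gs t xs ≡ map suc ys
  runAll-complete []       []       = 0 , refl
  runAll-complete (g ∷ gs) {xs} (e ∷ es) with run-complete g e | runAll-complete gs es
  ... | t₁ , g≡ | t₂ , gs≡ =
    t₁ ⊔ t₂ , cong₂ _∷_ (run-mono g xs (m≤m⊔n t₁ t₂) g≡) (runAll-mono gs xs _ (m≤n⊔m t₁ t₂) gs≡)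

count : {P : Pred ℕ 0ℓ} → Decidable P → ℕ → ℕ
count P? zero    = 0
count P? (suc n) = if does (P? n) then suc (count P? n) else count P? n

module _ {P Q : Pred ℕ 0ℓ} (P? : Decidable P) (Q? : Decidable Q) where

  count-mono : P ⊆ Q → ∀ n → count P? n ≤ count Q? n
  count-mono P⊆Q zero    = z≤n
  count-mono P⊆Q (suc n) with P? n | Q? n
  ... | yes p | yes _ = s≤s (count-mono P⊆Q n)
  ... | yes p | no ¬q = contradiction (P⊆Q p) ¬q
  ... | no _  | yes _ = m≤n⇒m≤1+n (count-mono P⊆Q n)
  ... | no _  | no _  = count-mono P⊆Q n

  count-mono-< : P ⊆ Q → ∀ {z n} → z < n → ¬ P z → Q z → count P? n < count Q? n
  count-mono-< P⊆Q {z} {suc n} z<1+n ¬pz qz with m<1+n⇒m<n∨m≡n z<1+n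
  ... | inj₂ refl with P? z | Q? z
  ...   | yes pz | _     = contradiction pz ¬pz
  ...   | no _   | no ¬q = contradiction qz ¬q
  ...   | no _   | yes _ = s≤s (count-mono P⊆Q z)
  count-mono-< P⊆Q {z} {suc n} z<1+n ¬pz qz | inj₁ z<n with P? n | Q? n
  ... | yes p | yes _ = s≤s (count-mono-< P⊆Q z<n ¬pz qz)
  ... | yes p | no ¬q = contradiction (P⊆Q p) ¬q
  ... | no _  | yes _ = m<n⇒m<1+n (count-mono-< P⊆Q z<n ¬pz qz)
  ... | no _  | no _  = count-mono-< P⊆Q z<n ¬pz qz

  count-suc-≤ : ∀ {z} → (∀ {y} → Q y → P y ⊎ y ≡ z) → ∀ n → count Q? n ≤ suc (count P? n)
  count-suc-≤ {z} Q⊆P∪z = go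
    where
    up-to-z : ∀ n → n ≤ z → count Q? n ≤ count P? n
    up-to-z zero    _     = z≤n
    up-to-z (suc n) 1+n≤z with Q? n | P? n
    ... | yes _ | yes _ = s≤s (up-to-z n (<⇒≤ 1+n≤z))
    ... | no _  | yes _ = m≤n⇒m≤1+n (up-to-z n (<⇒≤ 1+n≤z))
    ... | no _  | no _  = up-to-z n (<⇒≤ 1+n≤z)
    ... | yes q | no ¬p with Q⊆P∪z q
    ...   | inj₁ p    = contradiction p ¬p
    ...   | inj₂ refl = ⊥-elim (<-irrefl refl 1+n≤z)

    go : ∀ n → count Q? n ≤ suc (count P? n)
    go zero    = z≤n
    go (suc n) with Q? n | P? n
    ... | yes _ | yes _ = s≤s (go n)
    ... | no _  | yes _ = m≤n⇒m≤1+n (go n)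
    ... | no _  | no _  = go n
    ... | yes q | no ¬p with Q⊆P∪z q
    ...   | inj₁ p    = contradiction p ¬p
    ...   | inj₂ refl = s≤s (up-to-z n ≤-refl)

count-stable : {P : Pred ℕ 0ℓ} (P? : Decidable P) → ∀ {m} → (∀ {y} → m ≤ y → ¬ P y) →
               ∀ {n} → m ≤ n → count P? n ≡ count P? m
count-stable P? none {zero}  z≤n = refl
count-stable P? none {suc n} m≤1+n with m≤n⇒m<n∨m≡n m≤1+n
... | inj₂ refl = refl
... | inj₁ m<1+n with P? n
...   | yes p = contradiction p (none (s≤s⁻¹ m<1+n))
...   | no _  = count-stable P? none (s≤s⁻¹ m<1+n)

countᶜ : ∀ {n} → Code (suc n) → Code (suc n)
countᶜ p = precC zeroC (ifᶜ compC p (π₀ ∷ projsᶜ (λ i → suc (suc i))) then sucᶜ π₁ else π₁)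

countᶜ-eval : ∀ {n} {p : Code (suc n)} {xs} (f : ℕ → Bool) → (∀ y → Eval p (y ∷ xs) (bit (f y))) →
              ∀ N → Eval (countᶜ p) (N ∷ xs) (count (λ y → T? (f y)) N)
countᶜ-eval f p-eval zero    = precZ zeroE
countᶜ-eval {xs = xs} f p-eval (suc N) = precS (countᶜ-eval f p-eval N)
  (ifᶜ-eval (compE (projE ∷ projsᶜ-eval _ xs (λ i → refl)) (p-eval N)) (sucᶜ-eval projE) projE)

Least : Pred ℕ 0ℓ → ℕ → Set
Least P s = P s × (∀ j → j < s → ¬ P j)

least-below : {P : Pred ℕ 0ℓ} → Decidable P → ∀ b → (∀ j → j < b → ¬ P j) ⊎ ∃ (Least P)
least-below P? zero = inj₁ (λ j ())
least-below {P} P? (suc b) with least-below P? b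
... | inj₂ least = inj₂ least
... | inj₁ none-below-b with P? b
...   | yes pb = inj₂ (b , pb , none-below-b)
...   | no ¬pb = inj₁ none-below-1+b
  where
  none-below-1+b : ∀ j → j < suc b → ¬ P j
  none-below-1+b j j<1+b with m<1+n⇒m<n∨m≡n j<1+b
  ... | inj₁ j<b  = none-below-b j j<b
  ... | inj₂ refl = ¬pb

least-witness : {P : Pred ℕ 0ℓ} → Decidable P → ∀ {n} → P n → ∃ (Least P)
least-witness P? {n} pn with least-below P? (suc n)
... | inj₁ none  = contradiction pn (none n (n<1+n n))
... | inj₂ least = least

bit-not-true : ∀ {b} → T b → bit (not b) ≡ 0
bit-not-true {true} _ = refl

bit-not-false : ∀ {b} → ¬ T b → bit (not b) ≡ 1
bit-not-false {false} _   = refl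
bit-not-false {true}  ¬tt = contradiction _ ¬tt

firstᶜ : ∀ {n} → Code (suc n) → Code n
firstᶜ p = muC (notᶜ p)

firstᶜ-eval : ∀ {n} {p : Code (suc n)} {xs} (f : ℕ → Bool) → (∀ j → Eval p (j ∷ xs) (bit (f j))) →
              ∀ {s} → Least (λ j → T (f j)) s → Eval (firstᶜ p) xs s
firstᶜ-eval {p = p} {xs} f p-eval {s} (fs , minimal) =
  muE (subst (Eval (notᶜ p) (s ∷ xs)) (bit-not-true fs) (notᶜ-eval (p-eval s)))
      (λ j j<s → 0 , subst (Eval (notᶜ p) (j ∷ xs)) (bit-not-false (minimal j j<s)) (notᶜ-eval (p-eval j)))

crossing : (f : ℕ → ℕ) → ∀ {n b} → f 0 ≤ n → n < f b → ∃[ z ] f z ≤ n × n < f (suc z)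
crossing f {b = zero}  f0≤n n<f0 = contradiction f0≤n (<⇒≱ n<f0)
crossing f {n} {suc b} f0≤n n<f1+b with n <? f b
... | yes n<fb = crossing f f0≤n n<fb
... | no  n≮fb = b , ≮⇒≥ n≮fb , n<f1+b

-- Ranking a monotone enumeration

-- E t y: y has been enumerated by time t.
module Ranking (E : ℕ → ℕ → Bool)
               (E-mono : ∀ {t t′ y} → t ≤ t′ → T (E t y) → T (E t′ y))
               (E-bounded : ∀ {t y} → T (E t y) → y < t) where

  open ≤-Reasoning

  FirstAt : ℕ → ℕ → Set
  FirstAt s x = Least (λ t → T (E t x)) s

  firstAt-exists : ∀ {t x} → T (E t x) → ∃[ s ] FirstAt s x
  firstAt-exists {x = x} = least-witness (λ t → T? (E t x))

  -- y comes before x when ordering by stage, then by value; s is the stage of x.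
  precedes : ℕ → ℕ → ℕ → Bool
  precedes s x y = E (pred s) y ∨ (E s y ∧ (y <ᵇ x))

  rank : ℕ → ℕ → ℕ
  rank s x = count (λ y → T? (precedes s x y)) s

  precedes-earlier : ∀ s x {y} → T (E (pred s) y) → T (precedes s x y)
  precedes-earlier s x e = Equivalence.from T-∨ (inj₁ e)

  precedes-same : ∀ s x {y} → T (E s y) → y < x → T (precedes s x y)
  precedes-same s x e y<x = Equivalence.from T-∨ (inj₂ (Equivalence.from T-∧ (e , <⇒<ᵇ y<x)))

  precedes-cases : ∀ s x {y} → T (precedes s x y) → T (E (pred s) y) ⊎ (T (E s y) × y < x)
  precedes-cases s x {y} p with Equivalence.to T-∨ p
  ... | inj₁ e = inj₁ e
  ... | inj₂ q with Equivalence.to T-∧ q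
  ...   | e , y<ᵇx = inj₂ (e , <ᵇ⇒< y x y<ᵇx)

  precedes-beyond : ∀ s x {y} → s ≤ y → ¬ T (precedes s x y)
  precedes-beyond s x s≤y p with precedes-cases s x p
  ... | inj₁ e       = <⇒≱ (E-bounded e) (≤-trans pred[n]≤n s≤y)
  ... | inj₂ (e , _) = <⇒≱ (E-bounded e) s≤y

  precedes-irrefl : ∀ {s x} → FirstAt s x → ¬ T (precedes s x x)
  precedes-irrefl {zero}  (e , _)       _ = n≮0 (E-bounded e)
  precedes-irrefl {suc s} {x} (_ , minimal) p with precedes-cases (suc s) x p
  ... | inj₁ e         = minimal s (n<1+n s) e
  ... | inj₂ (_ , x<x) = <-irrefl refl x<x

  rank-<-stage : ∀ {s x s′ x′} → FirstAt s x → FirstAt s′ x′ → s < s′ → rank s x < rank s′ x′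
  rank-<-stage {s} {x} {s′} {x′} first@(e , _) _ s<s′ = begin-strict
    rank s x                                 ≡⟨ count-stable _ (precedes-beyond s x) (<⇒≤ s<s′) ⟨
    count (λ y → T? (precedes s x y)) s′     <⟨ count-mono-< _ _ before-x⊆before-x′ (<-trans (E-bounded e) s<s′)
                                                  (precedes-irrefl first) (precedes-earlier s′ x′ (E-mono s≤pred-s′ e)) ⟩
    rank s′ x′                               ∎
    where
    s≤pred-s′ : s ≤ pred s′
    s≤pred-s′ = <⇒≤pred s<s′
    before-x⊆before-x′ : (λ y → T (precedes s x y)) ⊆ (λ y → T (precedes s′ x′ y))
    before-x⊆before-x′ p with precedes-cases s x p
    ... | inj₁ e       = precedes-earlier s′ x′ (E-mono (≤-trans pred[n]≤n s≤pred-s′) e)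
    ... | inj₂ (e , _) = precedes-earlier s′ x′ (E-mono s≤pred-s′ e)

  rank-<-value : ∀ {s x x′} → FirstAt s x → x < x′ → rank s x < rank s x′
  rank-<-value {s} {x} {x′} first@(e , _) x<x′ =
    count-mono-< _ _ before-x⊆before-x′ (E-bounded e) (precedes-irrefl first) (precedes-same s x′ e x<x′)
    where
    before-x⊆before-x′ : (λ y → T (precedes s x y)) ⊆ (λ y → T (precedes s x′ y))
    before-x⊆before-x′ p with precedes-cases s x p
    ... | inj₁ e         = precedes-earlier s x′ e
    ... | inj₂ (e , y<x) = precedes-same s x′ e (<-trans y<x x<x′)

  rank-injective : ∀ {s x s′ x′} → FirstAt s x → FirstAt s′ x′ → rank s x ≡ rank s′ x′ → x ≡ x′
  rank-injective {s} {x} {s′} {x′} first first′ eq with <-cmp s s′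
  ... | tri< s<s′ _ _ = contradiction eq (<⇒≢ (rank-<-stage first first′ s<s′))
  ... | tri> _ _ s>s′ = contradiction (sym eq) (<⇒≢ (rank-<-stage first′ first s>s′))
  ... | tri≈ _ refl _ with <-cmp x x′
  ...   | tri< x<x′ _ _ = contradiction eq (<⇒≢ (rank-<-value first x<x′))
  ...   | tri≈ _ x≡x′ _ = x≡x′
  ...   | tri> _ _ x>x′ = contradiction (sym eq) (<⇒≢ (rank-<-value first′ x>x′))

  size : ℕ → ℕ
  size t = count (λ y → T? (E t y)) t

  size-stable : ∀ {s t} → s ≤ t → count (λ y → T? (E s y)) t ≡ size s
  size-stable = count-stable _ (λ s≤y e → <⇒≱ (E-bounded e) s≤y)

  NeverExhausted : Set
  NeverExhausted = ∀ t → ∃[ t′ ] ∃[ y ] T (E t′ y) × ¬ T (E t y)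

  size-grows : NeverExhausted → ∀ t → ∃[ t″ ] size t < size t″
  size-grows more t with more t
  ... | t′ , y , e′ , ¬e = t ⊔ t′ , (begin-strict
    size t                              ≡⟨ size-stable (m≤m⊔n t t′) ⟨
    count (λ z → T? (E t z)) (t ⊔ t′)   <⟨ count-mono-< _ _ (E-mono (m≤m⊔n t t′)) (E-bounded e″) ¬e e″ ⟩
    size (t ⊔ t′)                       ∎)
    where
    e″ : T (E (t ⊔ t′) y)
    e″ = E-mono (m≤n⊔m t t′) e′

  size-unbounded : NeverExhausted → ∀ n → ∃[ t ] n < size t
  size-unbounded more zero    = size-grows more 0
  size-unbounded more (suc n) with size-unbounded more n
  ... | t , n<size-t with size-grows more t
  ...   | t′ , size-t<size-t′ = t′ , ≤-<-trans n<size-t size-t<size-t′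

  rank-zero-≤-size : ∀ s → rank (suc s) 0 ≤ size s
  rank-zero-≤-size s = begin
    rank (suc s) 0                         ≤⟨ count-mono _ _ before-0⊆E-s (suc s) ⟩
    count (λ y → T? (E s y)) (suc s)       ≡⟨ size-stable (n≤1+n s) ⟩
    size s                                 ∎
    where
    before-0⊆E-s : (λ y → T (precedes (suc s) 0 y)) ⊆ (λ y → T (E s y))
    before-0⊆E-s p with precedes-cases (suc s) 0 p
    ... | inj₁ e        = e
    ... | inj₂ (_ , ())

  size-≤-rank : ∀ s → size s ≤ rank s s
  size-≤-rank s = count-mono _ _ (λ e → precedes-same s s e (E-bounded e)) s

  rank-suc-≤ : ∀ s z → rank s (suc z) ≤ suc (rank s z)
  rank-suc-≤ s z = count-suc-≤ _ _ before-1+z⊆before-z∪z s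
    where
    before-1+z⊆before-z∪z : ∀ {y} → T (precedes s (suc z) y) → T (precedes s z y) ⊎ y ≡ z
    before-1+z⊆before-z∪z p with precedes-cases s (suc z) p
    ... | inj₁ e = inj₁ (precedes-earlier s z e)
    ... | inj₂ (e , y<1+z) with m<1+n⇒m<n∨m≡n y<1+z
    ...   | inj₁ y<z = inj₁ (precedes-same s z e y<z)
    ...   | inj₂ y≡z = inj₂ y≡z

  rank-suc-≤-rank : ∀ {s z} → (T (E s z) → T (E (pred s) z)) → rank s (suc z) ≤ rank s z
  rank-suc-≤-rank {s} {z} not-new = count-mono _ _ before-1+z⊆before-z s
    where
    before-1+z⊆before-z : (λ y → T (precedes s (suc z) y)) ⊆ (λ y → T (precedes s z y))
    before-1+z⊆before-z p with precedes-cases s (suc z) p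
    ... | inj₁ e = precedes-earlier s z e
    ... | inj₂ (e , y<1+z) with m<1+n⇒m<n∨m≡n y<1+z
    ...   | inj₁ y<z  = precedes-same s z e y<z
    ...   | inj₂ refl = precedes-earlier s z (not-new e)

  rank-jump⇒new : ∀ {s z} → rank s z < rank s (suc z) → T (E s z) × ¬ T (E (pred s) z)
  rank-jump⇒new {s} {z} jump with T? (E s z) | T? (E (pred s) z)
  ... | yes e  | no ¬e′ = e , ¬e′
  ... | no ¬e  | _      = contradiction (rank-suc-≤-rank {s} {z} (λ e → contradiction e ¬e)) (<⇒≱ jump)
  ... | yes _  | yes e′ = contradiction (rank-suc-≤-rank {s} {z} (λ _ → e′)) (<⇒≱ jump)

  new⇒firstAt : ∀ {s z} → T (E (suc s) z) → ¬ T (E s z) → FirstAt (suc s) z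
  new⇒firstAt e ¬e′ = e , λ j j<1+s eʲ → ¬e′ (E-mono (s≤s⁻¹ j<1+s) eʲ)

  -- Find s with size s ≤ n < size (1 + s), then z with rank (1 + s) z ≤ n < rank (1 + s) (1 + z);
  -- ranks grow in steps of at most one, so rank (1 + s) z = n, and the jump makes z new at stage 1 + s.
  rank-surjective : NeverExhausted → ∀ n → ∃[ s ] ∃[ x ] FirstAt s x × rank s x ≡ n
  rank-surjective more n with size-unbounded more n
  ... | t , n<size-t with crossing size {b = t} z≤n n<size-t
  ... | s , size-s≤n , n<size-1+s
    with crossing (rank (suc s)) {b = suc s} (≤-trans (rank-zero-≤-size s) size-s≤n)
                  (<-≤-trans n<size-1+s (size-≤-rank (suc s)))
  ... | z , rank-z≤n , n<rank-1+z with rank-jump⇒new {suc s} {z} (≤-<-trans rank-z≤n n<rank-1+z)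
  ... | e , ¬e′ = suc s , z , new⇒firstAt {s} {z} e ¬e′ ,
                  ≤-antisym rank-z≤n (s≤s⁻¹ (<-≤-trans n<rank-1+z (rank-suc-≤ (suc s) z)))

incr : List Bool → List Bool
incr []          = false ∷ []
incr (false ∷ w) = true ∷ w
incr (true  ∷ w) = false ∷ incr w

enc-incr : ∀ w → enc (incr w) ≡ suc (enc w)
enc-incr []          = refl
enc-incr (false ∷ w) = refl
enc-incr (true  ∷ w) = cong suc (trans (cong (2 *_) (enc-incr w)) (*-suc 2 (enc w)))

dec : ℕ → List Bool
dec zero    = []
dec (suc n) = incr (dec n)

enc-dec : ∀ n → enc (dec n) ≡ n
enc-dec zero    = refl
enc-dec (suc n) = trans (enc-incr (dec n)) (cong suc (enc-dec n))

incr-incr : ∀ b w → incr (incr (b ∷ w)) ≡ b ∷ incr w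
incr-incr false w = refl
incr-incr true  w = refl

bit+2*suc : ∀ b m → bit b + 2 * suc m ≡ suc (suc (bit b + 2 * m))
bit+2*suc false m = *-suc 2 m
bit+2*suc true  m = cong suc (*-suc 2 m)

dec-bit+2* : ∀ b n → dec (suc (bit b + 2 * n)) ≡ b ∷ dec n
dec-bit+2* false zero    = refl
dec-bit+2* true  zero    = refl
dec-bit+2* b     (suc n) = begin
  dec (suc (bit b + 2 * suc n))          ≡⟨ cong (λ m → dec (suc m)) (bit+2*suc b n) ⟩
  incr (incr (dec (suc (bit b + 2 * n)))) ≡⟨ cong (λ w → incr (incr w)) (dec-bit+2* b n) ⟩
  incr (incr (b ∷ dec n))                ≡⟨ incr-incr b (dec n) ⟩
  b ∷ dec (suc n)                        ∎
  where open ≡-Reasoning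

dec-enc : ∀ w → dec (enc w) ≡ w
dec-enc []      = refl
dec-enc (b ∷ w) = trans (dec-bit+2* b (enc w)) (cong (b ∷_) (dec-enc w))

enc-injective : ∀ {v w} → enc v ≡ enc w → v ≡ w
enc-injective {v} {w} eq = trans (sym (dec-enc v)) (trans (cong dec eq) (dec-enc w))

Eval⇒PR : ∀ {c x v} → Eval c (x ∷ []) v → PR c (dec x) (dec v)
Eval⇒PR {c} {x} {v} = subst₂ (λ y u → Eval c (y ∷ []) u) (sym (enc-dec x)) (sym (enc-dec v))

-- The compression function of a recursively enumerable set

module Enumeration (c : Code 1) where

  enumerated : ℕ → ℕ → Bool
  enumerated t y = (y <ᵇ t) ∧ (0 <ᵇ run c t (y ∷ []))

  enumerated-intro : ∀ {t y v} → y < t → run c t (y ∷ []) ≡ suc v → T (enumerated t y)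
  enumerated-intro y<t halts = Equivalence.from T-∧ (<⇒<ᵇ y<t , subst (λ r → T (0 <ᵇ r)) (sym halts) _)

  enumerated-elim : ∀ {t y} → T (enumerated t y) → y < t × ∃[ v ] run c t (y ∷ []) ≡ suc v
  enumerated-elim {t} {y} e with Equivalence.to T-∧ e
  ... | y<ᵇt , halted = <ᵇ⇒< y t y<ᵇt , positive⇒suc (run c t (y ∷ [])) halted
    where
    positive⇒suc : ∀ r → T (0 <ᵇ r) → ∃[ v ] r ≡ suc v
    positive⇒suc (suc v) _ = v , refl

  enumerated-mono : ∀ {t t′ y} → t ≤ t′ → T (enumerated t y) → T (enumerated t′ y)
  enumerated-mono t≤t′ e with enumerated-elim e
  ... | y<t , _ , halts = enumerated-intro (<-≤-trans y<t t≤t′) (run-mono c _ t≤t′ halts)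

  enumerated-bounded : ∀ {t y} → T (enumerated t y) → y < t
  enumerated-bounded e = proj₁ (enumerated-elim e)

  enumerated-complete : ∀ {y v} → Eval c (y ∷ []) v → ∃[ t ] T (enumerated t y)
  enumerated-complete {y} halts with run-complete c halts
  ... | t , runs = t ⊔ suc y , enumerated-intro (m≤n⊔m t (suc y)) (run-mono c _ (m≤m⊔n t (suc y)) runs)

  enumerated-sound : ∀ {t y} → T (enumerated t y) → ∃[ v ] Eval c (y ∷ []) v
  enumerated-sound {t} e with enumerated-elim e
  ... | _ , v , halts = v , run-sound c t _ halts

  open Ranking enumerated enumerated-mono enumerated-bounded public

  -- arguments t ∷ y
  enumeratedᶜ : Code 2
  enumeratedᶜ = (π₁ <ᶜ π₀) ∧ᶜ positiveᶜ (runᶜ c)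

  enumeratedᶜ-eval : ∀ t y → Eval enumeratedᶜ (t ∷ y ∷ []) (bit (enumerated t y))
  enumeratedᶜ-eval t y = ∧ᶜ-eval (<ᶜ-eval projE projE) (positiveᶜ-eval (runᶜ-eval c t (y ∷ [])))

  -- arguments y ∷ s ∷ x
  precedesᶜ : Code 3
  precedesᶜ =
    compC enumeratedᶜ (predᶜ π₁ ∷ π₀ ∷ []) ∨ᶜ (compC enumeratedᶜ (π₁ ∷ π₀ ∷ []) ∧ᶜ (π₀ <ᶜ π₂))

  precedesᶜ-eval : ∀ y s x → Eval precedesᶜ (y ∷ s ∷ x ∷ []) (bit (precedes s x y))
  precedesᶜ-eval y s x =
    ∨ᶜ-eval (compE (predᶜ-eval projE ∷ projE ∷ []) (enumeratedᶜ-eval (pred s) y))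
            (∧ᶜ-eval (compE (projE ∷ projE ∷ []) (enumeratedᶜ-eval s y)) (<ᶜ-eval projE projE))

  stageᶜ : Code 1
  stageᶜ = firstᶜ enumeratedᶜ

  compressorᶜ : Code 1
  compressorᶜ = compC (countᶜ precedesᶜ) (stageᶜ ∷ stageᶜ ∷ π₀ ∷ [])

  compressorᶜ-eval : ∀ {s x} → FirstAt s x → Eval compressorᶜ (x ∷ []) (rank s x)
  compressorᶜ-eval {s} {x} first =
    compE (stage ∷ stage ∷ projE ∷ []) (countᶜ-eval (precedes s x) (λ y → precedesᶜ-eval y s x) s)
    where
    stage : Eval stageᶜ (x ∷ []) s
    stage = firstᶜ-eval (λ t → enumerated t x) (λ t → enumeratedᶜ-eval t x) first

module Compression (A : List Bool → Set) (c : Code 1)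
                   (A-dom : ∀ x → (A x → DefinedAt c x) × (DefinedAt c x → A x)) where

  open Enumeration c

  A⇒firstAt : ∀ {a} → A a → ∃[ s ] FirstAt s (enc a)
  A⇒firstAt {a} a∈A with proj₁ (A-dom a) a∈A
  ... | _ , halts = firstAt-exists (proj₂ (enumerated-complete halts))

  firstAt⇒A : ∀ {s x} → FirstAt s x → A (dec x)
  firstAt⇒A {x = x} (e , _) with enumerated-sound e
  ... | v , halts = proj₂ (A-dom (dec x)) (dec v , Eval⇒PR halts)

  infinite⇒neverExhausted : Infinite A → NeverExhausted
  infinite⇒neverExhausted A-infinite t with A-infinite (List.map dec (upTo t))
  ... | a , a∈A , a∉ with A⇒firstAt a∈A
  ... | s , e , _ = s , enc a , e , λ eₜ → a∉ (subst (_∈ List.map dec (upTo t)) (dec-enc a)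
                                                     (∈-map⁺ dec (∈-upTo⁺ (enumerated-bounded eₜ))))

  compressor-defined : ∀ a → A a → DefinedAt compressorᶜ a
  compressor-defined a a∈A with A⇒firstAt a∈A
  ... | s , first =
    dec (rank s (enc a)) , subst (Eval compressorᶜ (enc a ∷ [])) (sym (enc-dec _)) (compressorᶜ-eval first)

  compressor-onto : Infinite A → ∀ w → ∃[ a ] A a × PR compressorᶜ a w
  compressor-onto A-infinite w = preimage (rank-surjective (infinite⇒neverExhausted A-infinite) (enc w))
    where
    preimage : (∃[ s ] ∃[ x ] FirstAt s x × rank s x ≡ enc w) → ∃[ a ] A a × PR compressorᶜ a w
    preimage (s , x , first , rank≡) = dec x , firstAt⇒A first ,
      subst (PR compressorᶜ (dec x)) (dec-enc w)
            (Eval⇒PR (subst (Eval compressorᶜ (x ∷ [])) rank≡ (compressorᶜ-eval first)))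

  compressor-injective : ∀ a b → A a → A b → a ≢ b →
                         ∀ u v → PR compressorᶜ a u → PR compressorᶜ b v → u ≢ v
  compressor-injective a b a∈A b∈A a≢b u v a↦u b↦v refl with A⇒firstAt a∈A | A⇒firstAt b∈A
  ... | s , first | s′ , first′ = a≢b (enc-injective (rank-injective first first′
        (trans (Eval-functional compressorᶜ (compressorᶜ-eval first) a↦u)
               (Eval-functional compressorᶜ b↦v (compressorᶜ-eval first′)))))

proposition3 : (A : List Bool → Set) → RE A → Infinite A → FPR-Compressible A
proposition3 A (c , A-dom) A-infinite =
  compressorᶜ , compressor-defined , compressor-onto A-infinite , compressor-injective
  where
  open Enumeration c using (compressorᶜ)
  open Compression A c A-dom
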